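{- Let $p$ be an odd prime and $T_{8p}=\langle a,b\mid a^{2p}=b^{8}=e,\ a^{p}=b^{4},\ b^{ -1}ab=a^{ -1}\rangle$. Then $$\mathrm{Aut}(T_{8p})=\{\sigma_{\alpha,\beta},\ \tau_{\gamma,\delta}\mid \alpha,\gamma\in\mathbb{Z}_{2p}^{*},\ \beta,\delta\in\mathbb{Z}_{2p}\},$$ where $\sigma_{\alpha,\beta}$ is the automorphism with $\sigma_{\alpha,\beta}(a)=a^{\alpha}$, $\sigma_{\alpha,\beta}(b)=a^{\beta}b$, and $\tau_{\gamma,\delta}$ is the automorphism with $\tau_{\gamma,\delta}(a)=a^{\gamma}$, $\tau_{\gamma,\delta}(b)=a^{\delta}b^{3}$.
   Context: $\mathbb{Z}_{2p}^{*}$ denotes the multiplicative group of units modulo $2p$, and $\mathbb{Z}_{2p}$ the integers modulo $2p$. -}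

module Defs where

open import Data.Nat using (ℕ; zero; suc; _+_; _*_; _∸_; _≤ᵇ_; NonZero)
open import Data.Nat.Properties using (m*n≢0)
open import Data.Nat.DivMod using (_mod_)
open import Data.Nat.Coprimality using (Coprime)
open import Data.Fin using (Fin; toℕ)
open import Data.Product using (_×_; _,_; Σ; ∃; ∃-syntax)
open import Data.Bool using (if_then_else_)
open import Function.Definitions using (Bijective)
open import Relation.Binary.PropositionalEquality using (_≡_)

-- Every element has a unique normal form a^i b^j with i ∈ ℤ_{2p}, j ∈ {0,1,2,3}
-- (|T_{8p}| = 8p).  The pair (i , j) represents a^i b^j.
T : (p : ℕ) → Set
T p = Fin (2 * p) × Fin 4

module _ (p : ℕ) .{{_ : NonZero p}} where

  private
    instance
      nz2p : NonZero (2 * p)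
      nz2p = m*n≢0 2 p

  signed : ℕ → ℕ → ℕ
  signed zero          k = k
  signed (suc zero)    k = 2 * p ∸ k
  signed (suc (suc j)) k = signed j k

  -- (a^i b^j)(a^k b^l) = a^{i + (-1)^j k} b^{j+l}, and b^4 = a^p
  _·_ : T p → T p → T p
  (i , j) · (k , l) =
    ( (toℕ i + signed (toℕ j) (toℕ k)
        + (if 4 ≤ᵇ toℕ j + toℕ l then p else 0)) mod (2 * p)
    , (toℕ j + toℕ l) mod 4 )

  e : T p
  e = 0 mod (2 * p) , 0 mod 4

  a : T p
  a = 1 mod (2 * p) , 0 mod 4

  b : T p
  b = 0 mod (2 * p) , 1 mod 4

  _^_ : T p → ℕ → T p
  x ^ zero  = e
  x ^ suc n = x · (x ^ n)

  IsAut : (T p → T p) → Set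
  IsAut f = Bijective _≡_ _≡_ f × (∀ x y → f (x · y) ≡ f x · f y)

  Unit2p : Fin (2 * p) → Set
  Unit2p α = Coprime (toℕ α) (2 * p)

{-# OPTIONS --safe #-}
-- Write elements of T_{8p} in normal form a^i b^j (i mod 2p, j mod 4). Then
-- (a^i b^j)(a^k b^l) = a^(i + (-1)^j k + p·[j + l ≥ 4]) b^(j + l mod 4), so every identity in the group
-- splits into a congruence modulo 2p between exponents of a and an identity between exponents of b,
-- and the latter are finitely many and checked by evaluation.
--
-- σ_{α,β} acts by a^i b^j ↦ a^(αi + β·[j odd]) b^j. It respects the carry p because α is odd, so
-- α p ≡ p (mod 2p), and the same formula with α⁻¹ (mod 2p) inverts it. τ_{γ,δ} is σ_{γ,δ} followed
-- by the automorphism a ↦ a, b ↦ b³.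
--
-- Conversely, an automorphism f preserves the relation a (b a) = b. Comparing exponents of b in
-- f(a) (f(b) f(a)) = f(b) gives f(a) = a^i or a^i b², and in the second case the exponents of a give
-- p ≡ 0 (mod 2), which is false. For f(a) = a^i they give (1 + (-1)^l) i ≡ 0, where b^l is the b-part
-- of f(b); if l were even, f(a)² = e = f(e), contradicting injectivity as a² ≠ e. Finally a^i = f(a)
-- has the same order 2p as a, which makes i a unit modulo 2p.
module Submission where

open import Data.Bool using (true; false; if_then_else_)
open import Data.Fin using (Fin; toℕ; fromℕ<; _≟_)
open import Data.Fin.Patterns using (0F; 1F; 2F; 3F)
open import Data.Fin.Properties using (toℕ-fromℕ<; toℕ-injective; toℕ<n; all?)
open import Data.Integer using (ℤ; +_; 0ℤ; 1ℤ; -1ℤ; ∣_∣; _/ℕ_)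
open import Data.Integer.DivMod using (a≡a%ℕn+[a/ℕn]*n; n%ℕd<d)
open import Data.Integer.Divisibility.Signed
  using (divides; ∣⇒∣ᵤ; ∣ᵤ⇒∣; ∣m∣n⇒∣m+n; ∣m⇒∣-m; ∣n⇒∣m*n; ∣m⇒∣m*n; _∣?_)
  renaming (_∣_ to _∣ℤ_; ∣-trans to ∣ℤ-trans)
import Data.Integer.Properties as ℤ
open import Data.Integer.Tactic.RingSolver using (solve; solve-∀)
open import Data.List using (_∷_; [])
open import Data.Nat as ℕ using (ℕ; zero; suc; NonZero; _≤_; _<_)
open import Data.Nat.Coprimality using (Coprime; coprime-Bézout)
open import Data.Nat.DivMod using (_mod_; _%_; _/_; m≡m%n+[m/n]*n)
open import Data.Nat.Divisibility using (_∣_; _∣0; divides; ∣-refl; ∣-antisym; ∣⇒≤; m∣m*n; >⇒∤)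
import Data.Nat.Divisibility as ℕ
open import Data.Nat.GCD using (module Bézout)
open import Data.Nat.Primality using (Prime; prime⇒nonTrivial)
import Data.Nat.Properties as ℕ
import Data.Nat.Tactic.RingSolver as ℕ-Solver
open import Data.Product using (Σ; _×_; _,_; ∃-syntax; proj₁; proj₂)
open import Data.Sum using (_⊎_; inj₁; inj₂)
open import Function using (_∘_)
open import Function.Consequences.Propositional
  using (inverseᵇ⇒bijective; strictlyInverseˡ⇒inverseˡ; strictlyInverseʳ⇒inverseʳ)
import Function.Construct.Composition as Composition
open import Relation.Binary.Bundles using (Setoid)
open import Relation.Binary.Definitions using (Decidable)
open import Relation.Binary.PropositionalEquality
open import Relation.Binary.Structures using (IsEquivalence)
import Relation.Binary.Reasoning.Setoid as SetoidReasoning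
open import Relation.Nullary using (¬_; contradiction)
open import Relation.Nullary.Decidable using (map′; from-yes; _⊎-dec_; _→-dec_)

import Defs
open Defs using (T; signed; IsAut; Unit2p)

module Congruence (n : ℕ) where

  open Data.Integer using (_+_; _*_; -_; _-_)

  infix 4 _≈_ _≈?_
  record _≈_ (x y : ℤ) : Set where
    constructor congruent
    field divides-difference : + n ∣ℤ x - y
  open _≈_

  _≈?_ : Decidable _≈_
  x ≈? y = map′ congruent divides-difference (+ n ∣? x - y)

  congruent-by : ∀ {x y z} → + n ∣ℤ z → z ≡ x - y → x ≈ y
  congruent-by n∣z refl = congruent n∣z

  ≈-reflexive : ∀ {x y} → x ≡ y → x ≈ y
  ≈-reflexive {x} refl = congruent (divides 0ℤ (ℤ.+-inverseʳ x))

  ≈-refl : ∀ {x} → x ≈ x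
  ≈-refl = ≈-reflexive refl

  ≈-sym : ∀ {x y} → x ≈ y → y ≈ x
  ≈-sym {x} {y} (congruent n∣x-y) = congruent-by (∣m⇒∣-m n∣x-y) (solve (x ∷ y ∷ []))

  ≈-trans : ∀ {x y z} → x ≈ y → y ≈ z → x ≈ z
  ≈-trans {x} {y} {z} (congruent n∣x-y) (congruent n∣y-z) =
    congruent-by (∣m∣n⇒∣m+n n∣x-y n∣y-z) (solve (x ∷ y ∷ z ∷ []))

  ≈-isEquivalence : IsEquivalence _≈_
  ≈-isEquivalence = record { refl = ≈-refl ; sym = ≈-sym ; trans = ≈-trans }

  ≈-setoid : Setoid _ _
  ≈-setoid = record { isEquivalence = ≈-isEquivalence }

  +-cong : ∀ {x x′ y y′} → x ≈ x′ → y ≈ y′ → x + y ≈ x′ + y′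
  +-cong {x} {x′} {y} {y′} (congruent n∣x-x′) (congruent n∣y-y′) =
    congruent-by (∣m∣n⇒∣m+n n∣x-x′ n∣y-y′) (solve (x ∷ x′ ∷ y ∷ y′ ∷ []))

  *-cong : ∀ {x x′ y y′} → x ≈ x′ → y ≈ y′ → x * y ≈ x′ * y′
  *-cong {x} {x′} {y} {y′} (congruent n∣x-x′) (congruent n∣y-y′) =
    congruent-by (∣m∣n⇒∣m+n (∣m⇒∣m*n y n∣x-x′) (∣n⇒∣m*n x′ n∣y-y′)) (solve (x ∷ x′ ∷ y ∷ y′ ∷ []))

  +-cancelʳ : ∀ {x y} z → x + z ≈ y + z → x ≈ y
  +-cancelʳ {x} {y} z (congruent n∣x+z-[y+z]) = congruent-by n∣x+z-[y+z] (solve (x ∷ y ∷ z ∷ []))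

  +-multiple≈ : ∀ x k → x + k * + n ≈ x
  +-multiple≈ x k = congruent (divides k (x+y-x≡y x (k * + n)))
    where
    x+y-x≡y : ∀ x y → x + y - x ≡ y
    x+y-x≡y = solve-∀

  ≈0⇒∣ : ∀ {m} → + m ≈ 0ℤ → n ∣ m
  ≈0⇒∣ {m} (congruent n∣m-0) = subst (n ∣_) (ℕ.+-identityʳ m) (∣⇒∣ᵤ n∣m-0)

  ∣⇒≈0 : ∀ {m} → n ∣ m → + m ≈ 0ℤ
  ∣⇒≈0 {m} n∣m = congruent (∣ᵤ⇒∣ (subst (n ∣_) (sym (ℕ.+-identityʳ m)) n∣m))

  n∸k≈-k : ∀ {k} → k ≤ n → + (n ℕ.∸ k) ≈ - + k
  n∸k≈-k {k} k≤n = congruent (divides 1ℤ (begin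
    + (n ℕ.∸ k) - - + k  ≡⟨ cong (_+_ (+ (n ℕ.∸ k))) (ℤ.neg-involutive (+ k)) ⟩
    + (n ℕ.∸ k) + + k    ≡⟨ ℤ.pos-+ (n ℕ.∸ k) k ⟨
    + (n ℕ.∸ k ℕ.+ k)    ≡⟨ cong +_ (ℕ.m∸n+n≡m k≤n) ⟩
    + n                  ≡⟨ ℤ.*-identityˡ (+ n) ⟨
    1ℤ * + n             ∎))
    where open ≡-Reasoning

  ∣∧<⇒≡0 : ∀ {m} → n ∣ m → m < n → m ≡ 0
  ∣∧<⇒≡0 {zero}  _   _   = refl
  ∣∧<⇒≡0 {suc m} n∣m m<n = contradiction n∣m (>⇒∤ m<n)

  toℕ-≈⇒≡ : ∀ {i j : Fin n} → + toℕ i ≈ + toℕ j → i ≡ j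
  toℕ-≈⇒≡ {i} {j} (congruent n∣i-j) =
    toℕ-injective (ℤ.+-injective (ℤ.i-j≡0⇒i≡j _ _ (ℤ.∣i∣≡0⇒i≡0 distance≡0)))
    where
    distance<n : ∣ + toℕ i - + toℕ j ∣ < n
    distance<n = subst (ℕ._< n) (cong ∣_∣ (sym (ℤ.m-n≡m⊖n (toℕ i) (toℕ j))))
      (ℕ.≤-<-trans (ℤ.∣m⊝n∣≤m⊔n (toℕ i) (toℕ j)) (ℕ.⊔-pres-<m (toℕ<n i) (toℕ<n j)))
    distance≡0 : ∣ + toℕ i - + toℕ j ∣ ≡ 0
    distance≡0 = ∣∧<⇒≡0 (∣⇒∣ᵤ n∣i-j) distance<n

  coprime⇒invertible : ∀ {m} → Coprime m n → ∃[ u ] u * + m ≈ 1ℤ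
  coprime⇒invertible {m} c with coprime-Bézout c
  ... | Bézout.+- x y 1+yn≡xm = + x , (begin
    + x * + m            ≡⟨ ℤ.pos-* x m ⟨
    + (x ℕ.* m)          ≡⟨ cong +_ 1+yn≡xm ⟨
    + (1 ℕ.+ y ℕ.* n)    ≡⟨ cong (_+_ 1ℤ) (ℤ.pos-* y n) ⟩
    1ℤ + + y * + n       ≈⟨ +-multiple≈ 1ℤ (+ y) ⟩
    1ℤ                   ∎)
    where open SetoidReasoning ≈-setoid
  ... | Bézout.-+ x y 1+xm≡yn = - + x , (begin
    - + x * + m                  ≡⟨ -x*m≡1-[1+x*m] (+ x) (+ m) ⟩
    1ℤ + - (1ℤ + + x * + m)      ≡⟨ cong (λ z → 1ℤ + - (1ℤ + z)) (ℤ.pos-* x m) ⟨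
    1ℤ + - + (1 ℕ.+ x ℕ.* m)     ≡⟨ cong (λ z → 1ℤ + - + z) 1+xm≡yn ⟩
    1ℤ + - + (y ℕ.* n)           ≡⟨ cong (λ z → 1ℤ + - z) (ℤ.pos-* y n) ⟩
    1ℤ + - (+ y * + n)           ≡⟨ cong (_+_ 1ℤ) (ℤ.neg-distribˡ-* (+ y) (+ n)) ⟩
    1ℤ + - + y * + n             ≈⟨ +-multiple≈ 1ℤ (- + y) ⟩
    1ℤ                           ∎)
    where
    open SetoidReasoning ≈-setoid
    -x*m≡1-[1+x*m] : ∀ x m → - x * m ≡ 1ℤ + - (1ℤ + x * m)
    -x*m≡1-[1+x*m] = solve-∀

  module _ .{{_ : NonZero n}} where

    toℕ-mod≈ : ∀ m → + toℕ (m mod n) ≈ + m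
    toℕ-mod≈ m = ≈-sym (≈-trans (≈-reflexive m≡r+qn) (+-multiple≈ _ (+ (m / n))))
      where
      open ≡-Reasoning
      m≡r+qn : + m ≡ + toℕ (m mod n) + + (m / n) * + n
      m≡r+qn = begin
        + m                                ≡⟨ cong +_ (m≡m%n+[m/n]*n m n) ⟩
        + (m % n ℕ.+ m / n ℕ.* n)          ≡⟨ ℤ.pos-+ (m % n) _ ⟩
        + (m % n) + + (m / n ℕ.* n)        ≡⟨ cong₂ _+_ (cong +_ (sym (toℕ-fromℕ< _))) (ℤ.pos-* (m / n) n) ⟩
        + toℕ (m mod n) + + (m / n) * + n  ∎

    fromℤ : ℤ → Fin n
    fromℤ z = fromℕ< (n%ℕd<d z n)

    toℕ-fromℤ≈ : ∀ z → + toℕ (fromℤ z) ≈ z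
    toℕ-fromℤ≈ z = ≈-sym (≈-trans (≈-reflexive z≡r+qn) (+-multiple≈ _ (z /ℕ n)))
      where
      z≡r+qn : z ≡ + toℕ (fromℤ z) + (z /ℕ n) * + n
      z≡r+qn = trans (a≡a%ℕn+[a/ℕn]*n z n) (cong (λ r → + r + (z /ℕ n) * + n) (sym (toℕ-fromℕ< _)))

module _ {m k : ℕ} where

  open Data.Integer using (_*_; _-_)
  open Congruence using (congruent)

  *-scale : ∀ {x y} → Congruence._≈_ m x y → Congruence._≈_ (m ℕ.* k) (x * + k) (y * + k)
  *-scale {x} {y} (congruent (divides q x-y≡qm)) = congruent (divides q (begin
    x * + k - y * + k  ≡⟨ xk-yk≡[x-y]k x y (+ k) ⟩
    (x - y) * + k      ≡⟨ cong (_* + k) x-y≡qm ⟩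
    q * + m * + k      ≡⟨ ℤ.*-assoc q (+ m) (+ k) ⟩
    q * (+ m * + k)    ≡⟨ cong (q *_) (ℤ.pos-* m k) ⟨
    q * + (m ℕ.* k)    ∎))
    where
    open ≡-Reasoning
    xk-yk≡[x-y]k : ∀ x y k → x * k - y * k ≡ (x - y) * k
    xk-yk≡[x-y]k = solve-∀

  ≈-weaken : ∀ {x y} → m ∣ k → Congruence._≈_ k x y → Congruence._≈_ m x y
  ≈-weaken m∣k (congruent k∣x-y) = congruent (∣ℤ-trans (∣ᵤ⇒∣ m∣k) k∣x-y)

open Congruence 2 using () renaming (_≈_ to _≈₂_; _≈?_ to _≈₂?_)

odd⇒≈₂1 : ∀ m → ¬ 2 ∣ m → + m ≈₂ 1ℤ
odd⇒≈₂1 zero          2∤m   = contradiction (2 ∣0) 2∤m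
odd⇒≈₂1 (suc zero)    _     = Congruence.≈-refl 2
odd⇒≈₂1 (suc (suc m)) 2∤2+m = begin
  + (2 ℕ.+ m)  ≡⟨ cong +_ (ℕ.+-comm 2 m) ⟩
  + (m ℕ.+ 2)  ≈⟨ +-multiple≈ (+ m) 1ℤ ⟩
  + m          ≈⟨ odd⇒≈₂1 m (2∤2+m ∘ ℕ.∣m∣n⇒∣m+n ∣-refl) ⟩
  1ℤ           ∎
  where
  open Congruence 2
  open SetoidReasoning ≈-setoid

full-order⇒coprime : ∀ {n i} .{{_ : NonZero n}} → (∀ m → n ∣ m ℕ.* i → n ∣ m) → Coprime i n
full-order⇒coprime {n} {i} full-order {d} (divides r i≡rd , divides q n≡qd) =
  ℕ.*-cancelˡ-≡ d 1 q {{ℕ.≢-nonZero q≢0}} (trans (sym n≡qd) (trans n≡q (sym (ℕ.*-identityʳ q))))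
  where
  n∣qi : n ∣ q ℕ.* i
  n∣qi = divides r (begin
    q ℕ.* i          ≡⟨ cong (q ℕ.*_) i≡rd ⟩
    q ℕ.* (r ℕ.* d)  ≡⟨ ℕ-Solver.solve (q ∷ r ∷ d ∷ []) ⟩
    r ℕ.* (q ℕ.* d)  ≡⟨ cong (r ℕ.*_) n≡qd ⟨
    r ℕ.* n          ∎)
    where open ≡-Reasoning
  n≡q : n ≡ q
  n≡q = ∣-antisym (full-order q n∣qi) (divides d (trans n≡qd (ℕ.*-comm q d)))
  q≢0 : q ≢ 0
  q≢0 q≡0 = ℕ.≢-nonZero⁻¹ n (trans n≡q q≡0)

module BExponents where

  open Data.Integer using (_+_; _*_)

  sign : ℕ → ℤ
  sign zero          = 1ℤ
  sign (suc zero)    = -1ℤ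
  sign (suc (suc j)) = sign j

  infixl 6 _⊕_
  _⊕_ : Fin 4 → Fin 4 → Fin 4
  j ⊕ l = (toℕ j ℕ.+ toℕ l) mod 4

  -- b^j b^l = a^(p · overflow j l) b^(j ⊕ l), as b⁴ = a^p
  overflow : Fin 4 → Fin 4 → ℤ
  overflow j l = if 4 ℕ.≤ᵇ toℕ j ℕ.+ toℕ l then 1ℤ else 0ℤ

  parity : Fin 4 → ℤ
  parity j = + (toℕ j % 2)

  -- (b³)^j = a^(p · thrice-carry j) b^(thrice j)
  thrice : Fin 4 → Fin 4
  thrice j = (3 ℕ.* toℕ j) mod 4

  thrice-carry : Fin 4 → ℤ
  thrice-carry j = + (3 ℕ.* toℕ j / 4)

  ⊕-identityˡ : ∀ l → 0F ⊕ l ≡ l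
  ⊕-identityˡ = from-yes (all? λ l → 0F ⊕ l ≟ l)

  ⊕-idempotent⇒0F : ∀ j → j ⊕ j ≡ j → j ≡ 0F
  ⊕-idempotent⇒0F = from-yes (all? λ j → (j ⊕ j ≟ j) →-dec (j ≟ 0F))

  relation⇒even : ∀ j l → j ⊕ (l ⊕ j) ≡ l → j ≡ 0F ⊎ j ≡ 2F
  relation⇒even = from-yes (all? λ j → all? λ l → (j ⊕ (l ⊕ j) ≟ l) →-dec ((j ≟ 0F) ⊎-dec (j ≟ 2F)))

  overflow-zeroˡ : ∀ l → overflow 0F l ≡ 0ℤ
  overflow-zeroˡ = from-yes (all? λ l → overflow 0F l ℤ.≟ 0ℤ)

  overflow-zeroʳ : ∀ l → overflow l 0F ≡ 0ℤ
  overflow-zeroʳ = from-yes (all? λ l → overflow l 0F ℤ.≟ 0ℤ)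

  overflow-relation-2F : ∀ l → overflow l 2F + overflow 2F (l ⊕ 2F) ≡ 1ℤ
  overflow-relation-2F = from-yes (all? λ l → overflow l 2F + overflow 2F (l ⊕ 2F) ℤ.≟ 1ℤ)

  1+sign≈₂0 : ∀ l → 1ℤ + sign (toℕ l) ≈₂ 0ℤ
  1+sign≈₂0 = from-yes (all? λ (l : Fin 4) → 1ℤ + sign (toℕ l) ≈₂? 0ℤ)

  odd⊎sign≡1 : ∀ l → (l ≡ 1F ⊎ l ≡ 3F) ⊎ sign (toℕ l) ≡ 1ℤ
  odd⊎sign≡1 = from-yes (all? λ (l : Fin 4) → ((l ≟ 1F) ⊎-dec (l ≟ 3F)) ⊎-dec (sign (toℕ l) ℤ.≟ 1ℤ))

  parity-⊕ : ∀ j l → parity (j ⊕ l) ≡ parity j + sign (toℕ j) * parity l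
  parity-⊕ = from-yes (all? λ j → all? λ l → parity (j ⊕ l) ℤ.≟ parity j + sign (toℕ j) * parity l)

  thrice-⊕ : ∀ j l → thrice (j ⊕ l) ≡ thrice j ⊕ thrice l
  thrice-⊕ = from-yes (all? λ j → all? λ l → thrice (j ⊕ l) ≟ thrice j ⊕ thrice l)

  thrice-involutive : ∀ j → thrice (thrice j) ≡ j
  thrice-involutive = from-yes (all? λ j → thrice (thrice j) ≟ j)

  sign-thrice : ∀ j → sign (toℕ (thrice j)) ≡ sign (toℕ j)
  sign-thrice = from-yes (all? λ (j : Fin 4) → sign (toℕ (thrice j)) ℤ.≟ sign (toℕ j))

  thrice-carry-⊕ : ∀ j l → overflow j l + thrice-carry (j ⊕ l)
                           ≈₂ thrice-carry j + sign (toℕ j) * thrice-carry l + overflow (thrice j) (thrice l)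
  thrice-carry-⊕ = from-yes (all? λ j → all? λ l →
    overflow j l + thrice-carry (j ⊕ l)
      ≈₂? thrice-carry j + sign (toℕ j) * thrice-carry l + overflow (thrice j) (thrice l))

  thrice-carry-involutive : ∀ j → thrice-carry j + thrice-carry (thrice j) ≈₂ 0ℤ
  thrice-carry-involutive = from-yes (all? λ j → thrice-carry j + thrice-carry (thrice j) ≈₂? 0ℤ)

module T8p (p : ℕ) .{{_ : NonZero p}} where

  open Data.Integer using (_+_; _*_; -_; _-_)
  open BExponents

  N : ℕ
  N = 2 ℕ.* p

  instance
    N-nonZero : NonZero N
    N-nonZero = ℕ.m*n≢0 2 p

  open Congruence N
  open SetoidReasoning ≈-setoid

  P : ℤ
  P = + p

  infixl 7 _∙_
  _∙_ : T p → T p → T p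
  _∙_ = Defs._·_ p

  _^_ : T p → ℕ → T p
  _^_ = Defs._^_ p

  e a b : T p
  e = Defs.e p
  a = Defs.a p
  b = Defs.b p

  a-exp : T p → ℤ
  a-exp (i , _) = + toℕ i

  b-exp : T p → Fin 4
  b-exp = proj₂

  ≡-from-exps : ∀ {x y} → a-exp x ≈ a-exp y → b-exp x ≡ b-exp y → x ≡ y
  ≡-from-exps {i , j} {k , .j} i≈k refl = cong (_, j) (toℕ-≈⇒≡ i≈k)

  signed≈ : ∀ j {k} → k ≤ N → + signed p j k ≈ sign j * + k
  signed≈ zero          {k} _   = ≈-reflexive (sym (ℤ.*-identityˡ (+ k)))
  signed≈ (suc zero)    {k} k≤N = ≈-trans (n∸k≈-k k≤N) (≈-reflexive (sym (ℤ.-1*i≡-i (+ k))))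
  signed≈ (suc (suc j))     k≤N = signed≈ j k≤N

  carry≡overflow : ∀ j l → + (if 4 ℕ.≤ᵇ toℕ j ℕ.+ toℕ l then p else 0) ≡ overflow j l * P
  carry≡overflow j l with 4 ℕ.≤ᵇ toℕ j ℕ.+ toℕ l
  ... | true  = sym (ℤ.*-identityˡ P)
  ... | false = refl

  a-exp-∙ : ∀ x y →
    a-exp (x ∙ y) ≈ a-exp x + sign (toℕ (b-exp x)) * a-exp y + overflow (b-exp x) (b-exp y) * P
  a-exp-∙ (i , j) (k , l) = begin
    + toℕ ((toℕ i ℕ.+ signed p (toℕ j) (toℕ k) ℕ.+ carry) mod N)  ≈⟨ toℕ-mod≈ _ ⟩
    + (toℕ i ℕ.+ signed p (toℕ j) (toℕ k) ℕ.+ carry)             ≡⟨ ℤ.pos-+ _ carry ⟩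
    + (toℕ i ℕ.+ signed p (toℕ j) (toℕ k)) + + carry
      ≡⟨ cong₂ _+_ (ℤ.pos-+ (toℕ i) _) (carry≡overflow j l) ⟩
    + toℕ i + + signed p (toℕ j) (toℕ k) + overflow j l * P
      ≈⟨ +-cong (+-cong (≈-refl {+ toℕ i}) (signed≈ (toℕ j) (ℕ.<⇒≤ (toℕ<n k)))) (≈-refl {overflow j l * P}) ⟩
    + toℕ i + sign (toℕ j) * + toℕ k + overflow j l * P          ∎
    where
    carry : ℕ
    carry = if 4 ℕ.≤ᵇ toℕ j ℕ.+ toℕ l then p else 0

  a-exp-e : a-exp e ≈ 0ℤ
  a-exp-e = toℕ-mod≈ 0

  a-exp-a : a-exp a ≈ 1ℤ
  a-exp-a = toℕ-mod≈ 1

  a-exp-b : a-exp b ≈ 0ℤ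
  a-exp-b = toℕ-mod≈ 0

  a-exp-a-power-∙ : ∀ i y → a-exp ((i , 0F) ∙ y) ≈ + toℕ i + a-exp y
  a-exp-a-power-∙ i y = begin
    a-exp ((i , 0F) ∙ y)                                ≈⟨ a-exp-∙ (i , 0F) y ⟩
    + toℕ i + 1ℤ * a-exp y + overflow 0F (b-exp y) * P
      ≡⟨ cong₂ (λ u o → + toℕ i + u + o * P) (ℤ.*-identityˡ (a-exp y)) (overflow-zeroˡ (b-exp y)) ⟩
    + toℕ i + a-exp y + 0ℤ                              ≡⟨ ℤ.+-identityʳ _ ⟩
    + toℕ i + a-exp y                                   ∎

  b-exp-a-power-∙ : ∀ i y → b-exp ((i , 0F) ∙ y) ≡ b-exp y
  b-exp-a-power-∙ i y = ⊕-identityˡ (b-exp y)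

  a-power-∙ : ∀ i y → a-exp y ≈ 0ℤ → (i , 0F) ∙ y ≡ (i , b-exp y)
  a-power-∙ i y y≈0 = ≡-from-exps (begin
    a-exp ((i , 0F) ∙ y)  ≈⟨ a-exp-a-power-∙ i y ⟩
    + toℕ i + a-exp y     ≈⟨ +-cong (≈-refl {+ toℕ i}) y≈0 ⟩
    + toℕ i + 0ℤ          ≡⟨ ℤ.+-identityʳ (+ toℕ i) ⟩
    + toℕ i               ∎) (b-exp-a-power-∙ i y)

  a-exp-a-power-^ : ∀ i n → a-exp ((i , 0F) ^ n) ≈ + n * + toℕ i
  a-exp-a-power-^ i zero    = a-exp-e
  a-exp-a-power-^ i (suc n) = begin
    a-exp ((i , 0F) ∙ (i , 0F) ^ n)  ≈⟨ a-exp-a-power-∙ i ((i , 0F) ^ n) ⟩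
    + toℕ i + a-exp ((i , 0F) ^ n)   ≈⟨ +-cong (≈-refl {+ toℕ i}) (a-exp-a-power-^ i n) ⟩
    + toℕ i + + n * + toℕ i          ≡⟨ x+nx≡[1+n]x (+ toℕ i) (+ n) ⟩
    + suc n * + toℕ i                ∎
    where
    x+nx≡[1+n]x : ∀ x n → x + n * x ≡ (1ℤ + n) * x
    x+nx≡[1+n]x = solve-∀

  b-exp-a-power-^ : ∀ i n → b-exp ((i , 0F) ^ n) ≡ 0F
  b-exp-a-power-^ i zero    = refl
  b-exp-a-power-^ i (suc n) = trans (b-exp-a-power-∙ i ((i , 0F) ^ n)) (b-exp-a-power-^ i n)

  a-exp-a^ : ∀ n → a-exp (a ^ n) ≈ + n
  a-exp-a^ n = begin
    a-exp (a ^ n)    ≈⟨ a-exp-a-power-^ (1 mod N) n ⟩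
    + n * a-exp a    ≈⟨ *-cong (≈-refl {+ n}) a-exp-a ⟩
    + n * 1ℤ         ≡⟨ ℤ.*-identityʳ (+ n) ⟩
    + n              ∎

  a^-normal : ∀ i → a ^ toℕ i ≡ (i , 0F)
  a^-normal i = ≡-from-exps (a-exp-a^ (toℕ i)) (b-exp-a-power-^ (1 mod N) (toℕ i))

  a^∙b-normal : ∀ i → a ^ toℕ i ∙ b ≡ (i , 1F)
  a^∙b-normal i = trans (cong (_∙ b) (a^-normal i)) (a-power-∙ i b a-exp-b)

  a-exp-b∙ : ∀ y → overflow 1F (b-exp y) ≡ 0ℤ → a-exp y ≈ 0ℤ → a-exp (b ∙ y) ≈ 0ℤ
  a-exp-b∙ y no-overflow y≈0 = begin
    a-exp (b ∙ y)                                         ≈⟨ a-exp-∙ b y ⟩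
    a-exp b + -1ℤ * a-exp y + overflow 1F (b-exp y) * P
      ≈⟨ +-cong (+-cong a-exp-b (*-cong (≈-refl { -1ℤ}) y≈0)) (≈-reflexive (cong (_* P) no-overflow)) ⟩
    0ℤ                                                    ∎

  a^∙b³-normal : ∀ i → a ^ toℕ i ∙ b ^ 3 ≡ (i , 3F)
  a^∙b³-normal i = trans (cong (_∙ b ^ 3) (a^-normal i)) (a-power-∙ i (b ^ 3) a-exp-b³)
    where
    a-exp-b³ : a-exp (b ^ 3) ≈ 0ℤ
    a-exp-b³ = a-exp-b∙ (b ^ 2) refl (a-exp-b∙ (b ^ 1) refl (a-exp-b∙ e refl a-exp-e))

  a∙[b∙a]≡b : a ∙ (b ∙ a) ≡ b
  a∙[b∙a]≡b = ≡-from-exps (begin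
    a-exp (a ∙ (b ∙ a))                      ≈⟨ a-exp-a-power-∙ (1 mod N) (b ∙ a) ⟩
    a-exp a + a-exp (b ∙ a)                  ≈⟨ +-cong a-exp-a (a-exp-∙ b a) ⟩
    1ℤ + (a-exp b + -1ℤ * a-exp a + 0ℤ * P)
      ≈⟨ +-cong (≈-refl {1ℤ}) (+-cong (+-cong a-exp-b (*-cong (≈-refl { -1ℤ}) a-exp-a)) (≈-refl {0ℤ})) ⟩
    0ℤ                                       ≈⟨ a-exp-b ⟨
    a-exp b                                  ∎) refl

  idempotent⇒≡e : ∀ x → x ∙ x ≡ x → x ≡ e
  idempotent⇒≡e (i , j) x∙x≡x with ⊕-idempotent⇒0F j (cong b-exp x∙x≡x)
  ... | refl = ≡-from-exps (≈-trans i≈0 (≈-sym a-exp-e)) refl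
    where
    i≈0 : + toℕ i ≈ 0ℤ
    i≈0 = +-cancelʳ (+ toℕ i) (begin
      + toℕ i + + toℕ i            ≈⟨ a-exp-a-power-∙ i (i , 0F) ⟨
      a-exp ((i , 0F) ∙ (i , 0F))  ≡⟨ cong a-exp x∙x≡x ⟩
      + toℕ i                      ≡⟨ ℤ.+-identityˡ (+ toℕ i) ⟨
      0ℤ + + toℕ i                 ∎)

  Homomorphism : (T p → T p) → Set
  Homomorphism f = ∀ x y → f (x ∙ y) ≡ f x ∙ f y

  hom-e : ∀ {f} → Homomorphism f → f e ≡ e
  hom-e {f} f-hom = idempotent⇒≡e (f e) (trans (sym (f-hom e e)) (cong f (a-power-∙ (0 mod N) e a-exp-e)))

  hom-^ : ∀ {f} → Homomorphism f → ∀ x n → f (x ^ n) ≡ f x ^ n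
  hom-^ {f} f-hom x zero    = hom-e {f} f-hom
  hom-^ {f} f-hom x (suc n) = trans (f-hom x (x ^ n)) (cong (f x ∙_) (hom-^ {f} f-hom x n))

  inverse⇒IsAut : ∀ {f g} → (∀ y → f (g y) ≡ y) → (∀ x → g (f x) ≡ x) → Homomorphism f → IsAut p f
  inverse⇒IsAut {f} {g} f∘g≗id g∘f≗id f-hom =
    inverseᵇ⇒bijective (strictlyInverseˡ⇒inverseˡ {f⁻¹ = g} f f∘g≗id , strictlyInverseʳ⇒inverseʳ {f⁻¹ = g} f g∘f≗id) ,
    f-hom

  IsAut-∘ : ∀ {f g} → IsAut p f → IsAut p g → IsAut p (g ∘ f)
  IsAut-∘ {f} {g} (f-bij , f-hom) (g-bij , g-hom) =
    Composition.bijective _≡_ _≡_ _≡_ f-bij g-bij , λ x y → trans (cong g (f-hom x y)) (g-hom (f x) (f y))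

  relation-a-exp : ∀ i j y → sign (toℕ j) ≡ 1ℤ → (i , j) ∙ (y ∙ (i , j)) ≡ y →
    (1ℤ + sign (toℕ (b-exp y))) * + toℕ i + (overflow (b-exp y) j + overflow j (b-exp y ⊕ j)) * P ≈ 0ℤ
  relation-a-exp i j y@(k , l) s≡1 x∙[y∙x]≡y = +-cancelʳ Y (begin
    (1ℤ + s) * I + (o + o′) * P + Y                   ≡⟨ rearrange I Y s o o′ P ⟩
    I + 1ℤ * (Y + s * I + o * P) + o′ * P             ≡⟨ cong (λ t → I + t * (Y + s * I + o * P) + o′ * P) s≡1 ⟨
    I + sign (toℕ j) * (Y + s * I + o * P) + o′ * P
      ≈⟨ +-cong (+-cong (≈-refl {I}) (*-cong (≈-refl {sign (toℕ j)}) (a-exp-∙ y (i , j)))) (≈-refl {o′ * P}) ⟨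
    I + sign (toℕ j) * a-exp (y ∙ (i , j)) + o′ * P  ≈⟨ a-exp-∙ (i , j) (y ∙ (i , j)) ⟨
    a-exp ((i , j) ∙ (y ∙ (i , j)))                   ≡⟨ cong a-exp x∙[y∙x]≡y ⟩
    Y                                                 ≡⟨ ℤ.+-identityˡ Y ⟨
    0ℤ + Y                                            ∎)
    where
    I = + toℕ i
    Y = + toℕ k
    s = sign (toℕ l)
    o = overflow l j
    o′ = overflow j (l ⊕ j)
    rearrange : ∀ I Y s o o′ P → (1ℤ + s) * I + (o + o′) * P + Y ≡ I + 1ℤ * (Y + s * I + o * P) + o′ * P
    rearrange = solve-∀

  relation⇒a-power : ¬ 2 ∣ p → ∀ x y → x ∙ (y ∙ x) ≡ y →
    b-exp x ≡ 0F × (1ℤ + sign (toℕ (b-exp y))) * a-exp x ≈ 0ℤ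
  relation⇒a-power p-odd (i , j) y@(k , l) x∙[y∙x]≡y with relation⇒even j l (cong b-exp x∙[y∙x]≡y)
  ... | inj₁ refl = refl , ≈-trans (≈-reflexive (sym no-overflow)) (relation-a-exp i 0F y refl x∙[y∙x]≡y)
    where
    c = 1ℤ + sign (toℕ l)
    no-overflow : c * + toℕ i + (overflow l 0F + overflow 0F (l ⊕ 0F)) * P ≡ c * + toℕ i
    no-overflow = trans (cong₂ (λ o o′ → c * + toℕ i + (o + o′) * P) (overflow-zeroʳ l) (overflow-zeroˡ (l ⊕ 0F)))
                        (ℤ.+-identityʳ _)
  ... | inj₂ refl = contradiction (Mod2.≈0⇒∣ P≈₂0) p-odd
    where
    module Mod2 = Congruence 2
    c = 1ℤ + sign (toℕ l)
    I = + toℕ i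
    cI+P≈0 : c * I + P ≈ 0ℤ
    cI+P≈0 = begin
      c * I + P                                           ≡⟨ cong (_+_ (c * I)) (ℤ.*-identityˡ P) ⟨
      c * I + 1ℤ * P                                      ≡⟨ cong (λ o → c * I + o * P) (overflow-relation-2F l) ⟨
      c * I + (overflow l 2F + overflow 2F (l ⊕ 2F)) * P  ≈⟨ relation-a-exp i 2F y refl x∙[y∙x]≡y ⟩
      0ℤ                                                  ∎
    -- modulo 2 the coefficient c vanishes, leaving p ≡ 0
    P≈₂0 : P ≈₂ 0ℤ
    P≈₂0 = Mod2.≈-trans (Mod2.+-cong (Mod2.*-cong (Mod2.≈-sym (1+sign≈₂0 l)) (Mod2.≈-refl {I})) (Mod2.≈-refl {P}))
                        (≈-weaken (m∣m*n p) cI+P≈0)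

  Is-σ Is-τ : (T p → T p) → Fin N → Fin N → Set
  Is-σ f α β = f a ≡ a ^ toℕ α × f b ≡ a ^ toℕ β ∙ b
  Is-τ f γ δ = f a ≡ a ^ toℕ γ × f b ≡ a ^ toℕ δ ∙ b ^ 3

  odd⇒*P≈P : ∀ {A} → A ≈₂ 1ℤ → A * P ≈ P
  odd⇒*P≈P A≈₂1 = ≈-trans (*-scale A≈₂1) (≈-reflexive (ℤ.*-identityˡ P))

  module Sigma (α β : Fin N) where

    A B : ℤ
    A = + toℕ α
    B = + toℕ β

    -- σ (a^i b^j) = (a^α)^i (a^β b)^j, and (a^β b)² = b²
    σ : T p → T p
    σ (i , j) = (fromℤ (A * + toℕ i + parity j * B) , j)

    a-exp-σ : ∀ x → a-exp (σ x) ≈ A * a-exp x + parity (b-exp x) * B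
    a-exp-σ (i , j) = toℕ-fromℤ≈ _

    σ-a : σ a ≡ (α , 0F)
    σ-a = ≡-from-exps (begin
      a-exp (σ a)           ≈⟨ a-exp-σ a ⟩
      A * a-exp a + 0ℤ * B  ≈⟨ +-cong (*-cong (≈-refl {A}) a-exp-a) (≈-refl {0ℤ}) ⟩
      A * 1ℤ + 0ℤ           ≡⟨ trans (ℤ.+-identityʳ _) (ℤ.*-identityʳ A) ⟩
      A                     ∎) refl

    σ-b : σ b ≡ (β , 1F)
    σ-b = ≡-from-exps (begin
      a-exp (σ b)           ≈⟨ a-exp-σ b ⟩
      A * a-exp b + 1ℤ * B  ≈⟨ +-cong (*-cong (≈-refl {A}) a-exp-b) (≈-refl {1ℤ * B}) ⟩
      A * 0ℤ + 1ℤ * B       ≡⟨ cong₂ _+_ (ℤ.*-zeroʳ A) (ℤ.*-identityˡ B) ⟩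
      B                     ∎) refl

    σ-hom : A ≈₂ 1ℤ → Homomorphism σ
    σ-hom A-odd x@(i , j) y@(k , l) = ≡-from-exps (begin
      a-exp (σ (x ∙ y))                                        ≈⟨ a-exp-σ (x ∙ y) ⟩
      A * a-exp (x ∙ y) + parity (j ⊕ l) * B
        ≈⟨ +-cong (*-cong (≈-refl {A}) (a-exp-∙ x y)) (≈-reflexive (cong (_* B) (parity-⊕ j l))) ⟩
      A * (I + s * K + o * P) + (parity j + s * parity l) * B  ≡⟨ distribute A I K s o (parity j) (parity l) B P ⟩
      σI + s * σK + o * (A * P)
        ≈⟨ +-cong (≈-refl {σI + s * σK}) (*-cong (≈-refl {o}) (odd⇒*P≈P A-odd)) ⟩
      σI + s * σK + o * P
        ≈⟨ +-cong (+-cong (a-exp-σ x) (*-cong (≈-refl {s}) (a-exp-σ y))) (≈-refl {o * P}) ⟨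
      a-exp (σ x) + s * a-exp (σ y) + o * P                    ≈⟨ a-exp-∙ (σ x) (σ y) ⟨
      a-exp (σ x ∙ σ y)                                        ∎) refl
      where
      I = + toℕ i
      K = + toℕ k
      σI = A * I + parity j * B
      σK = A * K + parity l * B
      s = sign (toℕ j)
      o = overflow j l
      distribute : ∀ A I K s o πj πl B P →
        A * (I + s * K + o * P) + (πj + s * πl) * B ≡ (A * I + πj * B) + s * (A * K + πl * B) + o * (A * P)
      distribute = solve-∀

    module Inverse (U : ℤ) (U*A≈1 : U * A ≈ 1ℤ) where

      σ⁻¹ : T p → T p
      σ⁻¹ (m , j) = (fromℤ (U * (+ toℕ m - parity j * B)) , j)

      σ∘σ⁻¹ : ∀ y → σ (σ⁻¹ y) ≡ y
      σ∘σ⁻¹ y@(m , j) = ≡-from-exps (begin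
        a-exp (σ (σ⁻¹ y))      ≈⟨ a-exp-σ (σ⁻¹ y) ⟩
        A * a-exp (σ⁻¹ y) + O  ≈⟨ +-cong (*-cong (≈-refl {A}) (toℕ-fromℤ≈ _)) (≈-refl {O}) ⟩
        A * (U * (M - O)) + O  ≡⟨ reassociate A U M O ⟩
        U * A * (M - O) + O    ≈⟨ +-cong (*-cong U*A≈1 (≈-refl {M - O})) (≈-refl {O}) ⟩
        1ℤ * (M - O) + O       ≡⟨ cancel M O ⟩
        M                      ∎) refl
        where
        M = + toℕ m
        O = parity j * B
        reassociate : ∀ A U M O → A * (U * (M - O)) + O ≡ U * A * (M - O) + O
        reassociate = solve-∀
        cancel : ∀ M O → 1ℤ * (M - O) + O ≡ M
        cancel = solve-∀

      σ⁻¹∘σ : ∀ x → σ⁻¹ (σ x) ≡ x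
      σ⁻¹∘σ x@(i , j) = ≡-from-exps (begin
        a-exp (σ⁻¹ (σ x))      ≈⟨ toℕ-fromℤ≈ _ ⟩
        U * (a-exp (σ x) - O)  ≈⟨ *-cong (≈-refl {U}) (+-cong (a-exp-σ x) (≈-refl { - O})) ⟩
        U * (A * I + O - O)    ≡⟨ cancel U A I O ⟩
        U * A * I              ≈⟨ *-cong U*A≈1 (≈-refl {I}) ⟩
        1ℤ * I                 ≡⟨ ℤ.*-identityˡ I ⟩
        I                      ∎) refl
        where
        I = + toℕ i
        O = parity j * B
        cancel : ∀ U A I O → U * (A * I + O - O) ≡ U * A * I
        cancel = solve-∀

    σ-isAut : Unit2p p α → IsAut p σ
    σ-isAut α-unit =
      inverse⇒IsAut {σ} {σ⁻¹} σ∘σ⁻¹ σ⁻¹∘σ (σ-hom (odd⇒≈₂1 (toℕ α) λ 2∣α → contradiction (α-unit (2∣α , m∣m*n p)) λ ()))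
      where
      open Inverse (proj₁ (coprime⇒invertible α-unit)) (proj₂ (coprime⇒invertible α-unit))

  σ-exists : ∀ α β → Unit2p p α → ∃[ f ] (IsAut p f × Is-σ f α β)
  σ-exists α β α-unit = σ , σ-isAut α-unit , trans σ-a (sym (a^-normal α)) , trans σ-b (sym (a^∙b-normal β))
    where open Sigma α β

  -- ι (a^i b^j) = a^i (b³)^j, the automorphism fixing a and sending b to b³
  ι : T p → T p
  ι (i , j) = (fromℤ (+ toℕ i + thrice-carry j * P) , thrice j)

  a-exp-ι : ∀ x → a-exp (ι x) ≈ a-exp x + thrice-carry (b-exp x) * P
  a-exp-ι (i , j) = toℕ-fromℤ≈ _

  ι-involutive : ∀ x → ι (ι x) ≡ x
  ι-involutive x@(i , j) = ≡-from-exps (begin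
    a-exp (ι (ι x))                            ≈⟨ a-exp-ι (ι x) ⟩
    a-exp (ι x) + thrice-carry (thrice j) * P  ≈⟨ +-cong (a-exp-ι x) (≈-refl {w′ * P}) ⟩
    I + w * P + w′ * P                         ≡⟨ collect I w w′ P ⟩
    I + (w + w′) * P                           ≈⟨ +-cong (≈-refl {I}) (*-scale (thrice-carry-involutive j)) ⟩
    I + 0ℤ                                     ≡⟨ ℤ.+-identityʳ I ⟩
    I                                          ∎) (thrice-involutive j)
    where
    I = + toℕ i
    w = thrice-carry j
    w′ = thrice-carry (thrice j)
    collect : ∀ I w w′ P → I + w * P + w′ * P ≡ I + (w + w′) * P
    collect = solve-∀

  ι-hom : Homomorphism ι
  ι-hom x@(i , j) y@(k , l) = ≡-from-exps (begin
    a-exp (ι (x ∙ y))                          ≈⟨ a-exp-ι (x ∙ y) ⟩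
    a-exp (x ∙ y) + w * P                      ≈⟨ +-cong (a-exp-∙ x y) (≈-refl {w * P}) ⟩
    I + s * K + o * P + w * P                  ≡⟨ collect I K s o w P ⟩
    I + s * K + (o + w) * P                    ≈⟨ +-cong (≈-refl {I + s * K}) (*-scale (thrice-carry-⊕ j l)) ⟩
    I + s * K + (wj + s * wl + o′) * P         ≡⟨ distribute I K s wj wl o′ P ⟩
    (I + wj * P) + s * (K + wl * P) + o′ * P
      ≡⟨ cong (λ t → (I + wj * P) + t * (K + wl * P) + o′ * P) (sign-thrice j) ⟨
    (I + wj * P) + s′ * (K + wl * P) + o′ * P
      ≈⟨ +-cong (+-cong (a-exp-ι x) (*-cong (≈-refl {s′}) (a-exp-ι y))) (≈-refl {o′ * P}) ⟨
    a-exp (ι x) + s′ * a-exp (ι y) + o′ * P    ≈⟨ a-exp-∙ (ι x) (ι y) ⟨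
    a-exp (ι x ∙ ι y)                          ∎) (thrice-⊕ j l)
    where
    I = + toℕ i
    K = + toℕ k
    s = sign (toℕ j)
    s′ = sign (toℕ (thrice j))
    o = overflow j l
    o′ = overflow (thrice j) (thrice l)
    w = thrice-carry (j ⊕ l)
    wj = thrice-carry j
    wl = thrice-carry l
    collect : ∀ I K s o w P → I + s * K + o * P + w * P ≡ I + s * K + (o + w) * P
    collect = solve-∀
    distribute : ∀ I K s wj wl o′ P →
      I + s * K + (wj + s * wl + o′) * P ≡ (I + wj * P) + s * (K + wl * P) + o′ * P
    distribute = solve-∀

  ι-isAut : IsAut p ι
  ι-isAut = inverse⇒IsAut {ι} {ι} ι-involutive ι-involutive ι-hom

  ι-carry-free : ∀ i j → thrice-carry j ≡ 0ℤ → ι (i , j) ≡ (i , thrice j)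
  ι-carry-free i j no-carry = ≡-from-exps (begin
    a-exp (ι (i , j))             ≈⟨ a-exp-ι (i , j) ⟩
    + toℕ i + thrice-carry j * P  ≡⟨ cong (λ w → + toℕ i + w * P) no-carry ⟩
    + toℕ i + 0ℤ                  ≡⟨ ℤ.+-identityʳ (+ toℕ i) ⟩
    + toℕ i                       ∎) refl

  τ-exists : ∀ γ δ → Unit2p p γ → ∃[ f ] (IsAut p f × Is-τ f γ δ)
  τ-exists γ δ γ-unit =
    ι ∘ σ , IsAut-∘ (σ-isAut γ-unit) ι-isAut ,
    trans (cong ι σ-a) (trans (ι-carry-free γ 0F refl) (sym (a^-normal γ))) ,
    trans (cong ι σ-b) (trans (ι-carry-free δ 1F refl) (sym (a^∙b³-normal δ)))
    where open Sigma γ δ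

  module Classification (p-odd : ¬ 2 ∣ p) (1<p : 1 < p) {f : T p → T p} (f-aut : IsAut p f) where

    f-injective : ∀ {x y} → f x ≡ f y → x ≡ y
    f-injective = proj₁ (proj₁ f-aut)

    f-hom : Homomorphism f
    f-hom = proj₂ f-aut

    i k : Fin N
    i = proj₁ (f a)
    k = proj₁ (f b)

    l : Fin 4
    l = b-exp (f b)

    f-a-constraint : b-exp (f a) ≡ 0F × (1ℤ + sign (toℕ l)) * + toℕ i ≈ 0ℤ
    f-a-constraint = relation⇒a-power p-odd (f a) (f b)
      (trans (cong (f a ∙_) (sym (f-hom b a))) (trans (sym (f-hom a (b ∙ a))) (cong f a∙[b∙a]≡b)))

    f-a≡ : f a ≡ (i , 0F)
    f-a≡ = cong (i ,_) (proj₁ f-a-constraint)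

    f-a-full-order : ∀ n → N ∣ n ℕ.* toℕ i → N ∣ n
    f-a-full-order n N∣ni = ≈0⇒∣ (begin
      + n            ≈⟨ a-exp-a^ n ⟨
      a-exp (a ^ n)  ≡⟨ cong a-exp a^n≡e ⟩
      a-exp e        ≈⟨ a-exp-e ⟩
      0ℤ             ∎)
      where
      [i,0]^n≡e : (i , 0F) ^ n ≡ e
      [i,0]^n≡e = ≡-from-exps (begin
        a-exp ((i , 0F) ^ n)  ≈⟨ a-exp-a-power-^ i n ⟩
        + n * + toℕ i         ≡⟨ ℤ.pos-* n (toℕ i) ⟨
        + (n ℕ.* toℕ i)       ≈⟨ ∣⇒≈0 N∣ni ⟩
        0ℤ                    ≈⟨ a-exp-e ⟨
        a-exp e               ∎) (b-exp-a-power-^ i n)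
      a^n≡e : a ^ n ≡ e
      a^n≡e = f-injective (trans (hom-^ {f} f-hom a n)
                (trans (cong (_^ n) f-a≡) (trans [i,0]^n≡e (sym (hom-e {f} f-hom)))))

    i-unit : Unit2p p i
    i-unit = full-order⇒coprime f-a-full-order

    l-odd : l ≡ 1F ⊎ l ≡ 3F
    l-odd with odd⊎sign≡1 l
    ... | inj₁ odd = odd
    ... | inj₂ s≡1 = contradiction (∣⇒≤ (f-a-full-order 2 N∣2i)) (ℕ.<⇒≱ (ℕ.*-monoʳ-< 2 1<p))
      where
      N∣2i : N ∣ 2 ℕ.* toℕ i
      N∣2i = ≈0⇒∣ (≈-trans (≈-reflexive (trans (ℤ.pos-* 2 (toℕ i)) (cong (λ s → (1ℤ + s) * + toℕ i) (sym s≡1))))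
                           (proj₂ f-a-constraint))

    f-a-normal : f a ≡ a ^ toℕ i
    f-a-normal = trans f-a≡ (sym (a^-normal i))

    classification : (Σ (Fin N) λ α → Σ (Fin N) λ β → Unit2p p α × Is-σ f α β)
                   ⊎ (Σ (Fin N) λ γ → Σ (Fin N) λ δ → Unit2p p γ × Is-τ f γ δ)
    classification with l-odd
    ... | inj₁ l≡1 = inj₁ (i , k , i-unit , f-a-normal , trans (cong (k ,_) l≡1) (sym (a^∙b-normal k)))
    ... | inj₂ l≡3 = inj₂ (i , k , i-unit , f-a-normal , trans (cong (k ,_) l≡3) (sym (a^∙b³-normal k)))

open Defs using (a; b; _·_; _^_)
open import Data.Nat using (_*_)

lemma2p8 : (p : ℕ) .{{_ : NonZero p}} → Prime p → ¬ (2 ∣ p) →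
    -- every σ_{α,β} exists as an automorphism
    ((α β : Fin (2 * p)) → Unit2p p α →
      ∃[ f ] (IsAut p f × f (a p) ≡ _^_ p (a p) (toℕ α)
              × f (b p) ≡ _·_ p (_^_ p (a p) (toℕ β)) (b p)))
    -- every τ_{γ,δ} exists as an automorphism
    × ((γ δ : Fin (2 * p)) → Unit2p p γ →
      ∃[ f ] (IsAut p f × f (a p) ≡ _^_ p (a p) (toℕ γ)
              × f (b p) ≡ _·_ p (_^_ p (a p) (toℕ δ)) (_^_ p (b p) 3)))
    -- every automorphism is some σ_{α,β} or some τ_{γ,δ}
    × ((f : T p → T p) → IsAut p f →
      (Σ (Fin (2 * p)) λ α → Σ (Fin (2 * p)) λ β → (Unit2p p α × f (a p) ≡ _^_ p (a p) (toℕ α)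
              × f (b p) ≡ _·_ p (_^_ p (a p) (toℕ β)) (b p)))
      ⊎ (Σ (Fin (2 * p)) λ γ → Σ (Fin (2 * p)) λ δ → (Unit2p p γ × f (a p) ≡ _^_ p (a p) (toℕ γ)
              × f (b p) ≡ _·_ p (_^_ p (a p) (toℕ δ)) (_^_ p (b p) 3))))
lemma2p8 p p-prime p-odd =
  T8p.σ-exists p , T8p.τ-exists p ,
  λ f f-aut → T8p.Classification.classification p p-odd 1<p f-aut
  where
  -- primality of p is used only through 1 < p
  1<p : 1 < p
  1<p = ℕ.nonTrivial⇒n>1 p {{prime⇒nonTrivial p-prime}}
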